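{- Let $\Phi\in\mathbb{Z}[x,y]$ be a non-degenerate binary form of degree $k$, differential dimension $N$ and differential degree $K$, and set $M=\lceil N/2\rceil$. Then $$K/k\le M+\tfrac12.$$
   Context: $\Phi^{u,v}=\frac{\partial^{u+v}}{\partial x^u\partial y^v}\Phi$. Non-degenerate means $\Phi$ is not of the form $(\alpha x+\beta y)^k$ with $\alpha,\beta\in\mathbb{C}$. The differential dimension $N$ is the dimension of the span of $\{\Phi^{u,v}:0\le u+v<k\}$; for a maximal linearly independent subset $\{F_1,\dots,F_N\}$ of this set, the differential degree is $K=\sum_i\deg F_i$. -}

module Defs where

open import Data.Nat as ℕ using (ℕ; zero; suc; _∸_)
open import Data.Integer as ℤ using (ℤ; +_)
open import Data.Rational using (ℚ; 0ℚ; 1ℚ; _/_)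
import Data.Rational as ℚ
open import Data.Fin using (Fin)
import Data.Fin as Fin
open import Data.Product using (_×_; _,_; proj₁; proj₂; Σ; ∃)
open import Data.Sum using (_⊎_)
open import Relation.Binary.PropositionalEquality using (_≡_)
open import Relation.Nullary using (¬_)

-- A polynomial in x,y with coefficients in A is represented by its
-- coefficient function: P i j = coefficient of x^i y^j.
IntPoly : Set
IntPoly = ℕ → ℕ → ℤ

RatPoly : Set
RatPoly = ℕ → ℕ → ℚ

IsBinaryForm : ℕ → IntPoly → Set
IsBinaryForm k Φ = ∀ i j → ¬ (i ℕ.+ j ≡ k) → Φ i j ≡ + 0

∂x : IntPoly → IntPoly
∂x P i j = + (suc i) ℤ.* P (suc i) j

∂y : IntPoly → IntPoly
∂y P i j = + (suc j) ℤ.* P i (suc j)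

∂x^ : ℕ → IntPoly → IntPoly
∂x^ zero    P = P
∂x^ (suc u) P = ∂x (∂x^ u P)

∂y^ : ℕ → IntPoly → IntPoly
∂y^ zero    P = P
∂y^ (suc v) P = ∂y (∂y^ v P)

D : ℕ → ℕ → IntPoly → IntPoly
D u v Φ = ∂x^ u (∂y^ v Φ)

toℚ : ℤ → ℚ
toℚ z = z / 1

Σℚ : (m : ℕ) → (Fin m → ℚ) → ℚ
Σℚ zero    f = 0ℚ
Σℚ (suc m) f = f Fin.zero ℚ.+ Σℚ m (λ l → f (Fin.suc l))

Σℕ : (m : ℕ) → (Fin m → ℕ) → ℕ
Σℕ zero    f = 0
Σℕ (suc m) f = f Fin.zero ℕ.+ Σℕ m (λ l → f (Fin.suc l))

-- Linear independence over ℚ (equivalently over ℂ, the coefficients being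
-- rational) of a finite family of integer polynomials.
LinIndep : (m : ℕ) → (Fin m → IntPoly) → Set
LinIndep m F =
  (c : Fin m → ℚ) →
  (∀ i j → Σℚ m (λ l → c l ℚ.* toℚ (F l i j)) ≡ 0ℚ) →
  ∀ l → c l ≡ 0ℚ

derivFamily : (m : ℕ) → (Fin m → ℕ × ℕ) → IntPoly → Fin m → IntPoly
derivFamily m S Φ l = D (proj₁ (S l)) (proj₂ (S l)) Φ

extend : {m : ℕ} → ℕ × ℕ → (Fin m → ℕ × ℕ) → Fin (suc m) → ℕ × ℕ
extend p S Fin.zero    = p
extend p S (Fin.suc l) = S l

IsMaxIndepSubset : ℕ → IntPoly → (m : ℕ) → (Fin m → ℕ × ℕ) → Set
IsMaxIndepSubset k Φ m S =
  (∀ l → proj₁ (S l) ℕ.+ proj₂ (S l) ℕ.< k)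
  × (∀ l l' → S l ≡ S l' → l ≡ l')
  × LinIndep m (derivFamily m S Φ)
  × (∀ u v → u ℕ.+ v ℕ.< k →
       (∃ λ l → S l ≡ (u , v))
       ⊎ ¬ LinIndep (suc m) (derivFamily (suc m) (extend (u , v) S) Φ))

-- differential degree: sum of degrees of the F_l; Φ^{u,v} (nonzero, as a
-- member of an independent family) is a form of degree k - u - v.
diffDegree : ℕ → (m : ℕ) → (Fin m → ℕ × ℕ) → ℕ
diffDegree k m S = Σℕ m (λ l → k ∸ (proj₁ (S l) ℕ.+ proj₂ (S l)))

Σ< : ℕ → (ℕ → ℚ) → ℚ
Σ< zero    f = 0ℚ
Σ< (suc n) f = Σ< n f ℚ.+ f n

mulP : RatPoly → RatPoly → RatPoly
mulP P Q i j = Σ< (suc i) λ a → Σ< (suc j) λ b → P a b ℚ.* Q (i ∸ a) (j ∸ b)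

oneP : RatPoly
oneP zero zero = 1ℚ
oneP _    _    = 0ℚ

powP : RatPoly → ℕ → RatPoly
powP P zero    = oneP
powP P (suc n) = mulP P (powP P n)

linForm : ℚ → ℚ → RatPoly
linForm a b 1 0 = a
linForm a b 0 1 = b
linForm a b _ _ = 0ℚ

-- Degenerate: Φ = c (a x + b y)^k. (Over ℂ this is "(αx+βy)^k"; for an
-- integer form of degree k ≥ 1 this is equivalent to rational c, a, b.)
Degenerate : ℕ → IntPoly → Set
Degenerate k Φ = Σ ℚ λ c → Σ ℚ λ a → Σ ℚ λ b →
  ∀ i j → toℚ (Φ i j) ≡ c ℚ.* powP (linForm a b) k i j

module Submission where

-- Let F_l = Φ^{u_l,v_l} (l < N) be a maximal independent family of derivatives
-- of the degree-k form Φ, with orders o_l = u_l + v_l, so K = Σ_l (k − o_l),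
-- and let c_j count the members of order j.  The identity
-- i! j! Φ^{u,v}_{i,j} = u! v! Φ^{i,j}_{u,v} makes "evaluate Φ^{u,v} at the
-- exponent (i , j)" a symmetric pairing, which vanishes unless the two orders
-- add up to k.  If c_{k−j} < c_j, an under-determined linear system yields a
-- nonzero combination of members of order j that pairs to zero with every
-- member of order k − j; by maximality it pairs to zero with every derivative
-- of order k − j, so by symmetry the combination is the zero polynomial,
-- contradicting independence.  Hence c_j ≤ c_{k−j}; with c_0 ≤ 1 a counting
-- argument over the orders gives 2 K ≤ c_0 k + N k ≤ (N + 1) k.

open import Defs
open import Data.Nat as ℕ using (ℕ)
open import Data.Fin using (Fin)
open import Data.Product using (_×_)

module Rationals where

  open import Data.Nat using (zero; suc)
  open import Data.Integer as ℤ using (ℤ; +_; -[1+_])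
  import Data.Nat.Coprimality as Coprimality
  open import Data.Rational using (ℚ; 0ℚ; 1ℚ; _+_; _*_; -_; mkℚ; 1/_; ≢-nonZero)
  import Data.Rational.Properties as ℚP
  open import Data.Fin using (Fin; zero; suc)
  open import Algebra.Bundles using (CommutativeRing)
  open import Relation.Binary.PropositionalEquality

  open import Algebra.Properties.Semiring.Sum (CommutativeRing.semiring ℚP.+-*-commutativeRing) public

  zero-divisor : ∀ p q → p * q ≡ 0ℚ → p ≢ 0ℚ → q ≡ 0ℚ
  zero-divisor p q pq≡0 p≢0 = begin
      q                 ≡⟨ sym (ℚP.*-identityˡ q) ⟩
      1ℚ * q            ≡⟨ cong (_* q) (sym (ℚP.*-inverseˡ p)) ⟩
      (1/ p) * p * q    ≡⟨ ℚP.*-assoc (1/ p) p q ⟩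
      (1/ p) * (p * q)  ≡⟨ cong ((1/ p) *_) pq≡0 ⟩
      (1/ p) * 0ℚ       ≡⟨ ℚP.*-zeroʳ (1/ p) ⟩
      0ℚ                ∎
    where
      open ≡-Reasoning
      instance p-nonZero = ≢-nonZero p≢0

  *-swap : ∀ a b c → a * (b * c) ≡ b * (a * c)
  *-swap a b c = trans (sym (ℚP.*-assoc a b c)) (trans (cong (_* c) (ℚP.*-comm a b)) (ℚP.*-assoc b a c))

  *-nonzero : ∀ p q → p ≢ 0ℚ → q ≢ 0ℚ → p * q ≢ 0ℚ
  *-nonzero p q p≢0 q≢0 pq≡0 = q≢0 (zero-divisor p q pq≡0 p≢0)

  toℚ-normal : ∀ z → toℚ z ≡ mkℚ z 0 (Coprimality.sym (Coprimality.1-coprimeTo ℤ.∣ z ∣))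
  toℚ-normal (+ n)    = ℚP.normalize-coprime {n} {0} _
  toℚ-normal -[1+ n ] = cong -_ (ℚP.normalize-coprime {suc n} {0} _)

  toℚ-* : ∀ a b → toℚ (a ℤ.* b) ≡ toℚ a * toℚ b
  toℚ-* a b rewrite toℚ-normal a | toℚ-normal b = refl

  toℚ-zero : ∀ z → toℚ z ≡ 0ℚ → z ≡ + 0
  toℚ-zero z toℚz≡0 = trans (sym (↥toℚ z)) (ℚP.p≡0⇒↥p≡0 _ toℚz≡0)
    where
      ↥toℚ : ∀ z → Data.Rational.↥ (toℚ z) ≡ z
      ↥toℚ z rewrite toℚ-normal z = refl

  Σℚ≡sum : ∀ n (f : Fin n → ℚ) → Σℚ n f ≡ sum f
  Σℚ≡sum zero    f = refl
  Σℚ≡sum (suc n) f = cong (λ s → f zero + s) (Σℚ≡sum n (λ l → f (suc l)))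

  sum-zero : ∀ {n} (f : Fin n → ℚ) → (∀ l → f l ≡ 0ℚ) → sum f ≡ 0ℚ
  sum-zero {n} f f≡0 = trans (sum-cong-≗ f≡0) (sum-replicate-zero n)

module Counts where

  open import Data.Nat using (ℕ; zero; suc; _+_; _<_; _≤_; _≡ᵇ_; z<s; s<s⁻¹)
  import Data.Nat.Properties as ℕP
  open import Data.Bool using (Bool; true; false; T; if_then_else_)
  open import Data.Fin using (Fin; zero; suc; _≟_; punchIn)
  open import Data.Fin.Properties using (punchInᵢ≢i)
  open import Data.Product using (∃; _,_; _×_)
  open import Function using (_∘_)
  open import Data.Empty using (⊥; ⊥-elim)
  open import Relation.Nullary using (yes; no; does)
  open import Relation.Nullary.Decidable using (dec-false)
  open import Relation.Binary.PropositionalEquality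
  open import Algebra.Properties.Semiring.Sum ℕP.+-*-semiring using (sum; sum-remove; sum-cong-≗)

  ⟦_⟧ : Bool → ℕ
  ⟦ true ⟧  = 1
  ⟦ false ⟧ = 0

  count : ∀ {n} → (Fin n → Bool) → ℕ
  count P = sum (λ l → ⟦ P l ⟧)

  level : ∀ {n} → (Fin n → ℕ) → ℕ → Fin n → Bool
  level order j l = order l ≡ᵇ j

  remove : ∀ {n} → (Fin n → Bool) → Fin n → Fin n → Bool
  remove P l₀ l = if does (l₀ ≟ l) then false else P l

  remove-member : ∀ {n} (P : Fin n → Bool) l₀ l → T (remove P l₀ l) → T (P l) × l₀ ≢ l
  remove-member P l₀ l Rl with l₀ ≟ l
  ... | no l₀≢l = Rl , l₀≢l

  remove-other : ∀ {n} (P : Fin n → Bool) l₀ l → l₀ ≢ l → remove P l₀ l ≡ P l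
  remove-other P l₀ l l₀≢l rewrite dec-false (l₀ ≟ l) l₀≢l = refl

  count-tail : ∀ {n} (P : Fin (suc n) → Bool) → count (λ l → P (suc l)) ≤ count P
  count-tail P = ℕP.m≤n+m _ ⟦ P zero ⟧

  count-head : ∀ {n} (P : Fin (suc n) → Bool) → T (P zero) → count P ≡ suc (count (λ l → P (suc l)))
  count-head P P₀ with P zero
  ... | true = refl

  count-witness : ∀ {n} (P : Fin n → Bool) → 0 < count P → ∃ λ l → T (P l)
  count-witness {zero}  P ()
  count-witness {suc n} P 0<count with P zero in P₀
  ... | true  = zero , subst T (sym P₀) _
  ... | false with count-witness (λ l → P (suc l)) 0<count
  ...   | l , Pl = suc l , Pl

  count-remove : ∀ {n} (P : Fin n → Bool) l₀ → T (P l₀) → count P ≡ suc (count (remove P l₀))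
  count-remove {suc n} P l₀ Pl₀ = begin
      count P                                ≡⟨ sum-remove {i = l₀} (λ l → ⟦ P l ⟧) ⟩
      ⟦ P l₀ ⟧ + rest P                      ≡⟨ cong₂ _+_ (member Pl₀) (sum-cong-≗ others) ⟩
      suc (rest R)                           ≡⟨ cong (λ b → suc (⟦ b ⟧ + rest R)) (sym removed) ⟩
      suc (⟦ R l₀ ⟧ + rest R)                ≡⟨ cong suc (sym (sum-remove {i = l₀} (λ l → ⟦ R l ⟧))) ⟩
      suc (count R)                          ∎
    where
      open ≡-Reasoning
      R = remove P l₀
      rest : (Fin (suc n) → Bool) → ℕ
      rest Q = sum (λ j → ⟦ Q (punchIn l₀ j) ⟧)
      member : ∀ {b} → T b → ⟦ b ⟧ ≡ 1
      member {true} _ = refl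
      others : ∀ j → ⟦ P (punchIn l₀ j) ⟧ ≡ ⟦ R (punchIn l₀ j) ⟧
      others j = cong ⟦_⟧ (sym (remove-other P l₀ _ (punchInᵢ≢i l₀ j ∘ sym)))
      removed : R l₀ ≡ false
      removed with l₀ ≟ l₀
      ... | yes _     = refl
      ... | no l₀≢l₀ = ⊥-elim (l₀≢l₀ refl)

  count-unique : ∀ {n} (P : Fin n → Bool) → (∀ l l' → T (P l) → T (P l') → l ≡ l') → count P ≤ 1
  count-unique P unique = ℕP.≮⇒≥ two-members
    where
      two-members : 1 < count P → ⊥
      two-members 1<count with count-witness P (ℕP.<-trans z<s 1<count)
      ... | l , Pl with count-witness (remove P l) (s<s⁻¹ (subst (1 <_) (count-remove P l Pl) 1<count))
      ... | l' , Rl' with remove-member P l l' Rl'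
      ... | Pl' , l≢l' = l≢l' (unique l l' Pl Pl')

module LinearSystems where

  open Rationals
  open Counts using (count; remove; remove-member; count-tail; count-head; count-witness; count-remove)
  open import Data.Nat as ℕ using (ℕ; zero; suc)
  import Data.Nat.Properties as ℕP
  open import Data.Rational using (ℚ; 0ℚ; 1ℚ; _+_; _*_; _-_; -_; _≟_)
  import Data.Rational.Properties as ℚP
  open import Data.Bool using (Bool; T; if_then_else_)
  open import Data.Fin as Fin using (Fin; zero; suc; punchIn)
  open import Data.Fin.Properties using (punchInᵢ≢i; any?)
  open import Data.Product using (∃; _,_; _×_; proj₁; proj₂)
  open import Data.Sum using (_⊎_; inj₁; inj₂)
  open import Data.Empty using (⊥-elim)
  open import Function using (_∘_)
  open import Relation.Nullary using (¬_; yes; no; does; _×-dec_; ¬?)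
  open import Relation.Nullary.Decidable using (dec-false; T?; decidable-stable; dec⇒maybe)
  open import Relation.Binary.PropositionalEquality
  import Tactic.RingSolver.Core.AlmostCommutativeRing as ACR
  open import Tactic.RingSolver using (solve-∀)

  ℚ-ring : ACR.AlmostCommutativeRing _ _
  ℚ-ring = ACR.fromCommutativeRing ℚP.+-*-commutativeRing (λ q → dec⇒maybe (0ℚ ≟ q))

  unit : ∀ {n} → Fin n → Fin n → ℚ
  unit i l = if does (i Fin.≟ l) then 1ℚ else 0ℚ

  unit-diag : ∀ {n} (i : Fin n) → unit i i ≡ 1ℚ
  unit-diag i with i Fin.≟ i
  ... | yes _   = refl
  ... | no i≢i = ⊥-elim (i≢i refl)

  unit-off : ∀ {n} (i l : Fin n) → i ≢ l → unit i l ≡ 0ℚ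
  unit-off i l i≢l rewrite dec-false (i Fin.≟ l) i≢l = refl

  sum-unit : ∀ {n} (i : Fin n) (y : Fin n → ℚ) → sum (λ l → unit i l * y l) ≡ y i
  sum-unit {suc n} i y = begin
      sum (λ l → unit i l * y l)                            ≡⟨ sum-remove {i = i} (λ l → unit i l * y l) ⟩
      unit i i * y i + sum (λ j → unit i (punchIn i j) * y (punchIn i j))
        ≡⟨ cong₂ _+_ (cong (_* y i) (unit-diag i)) (sum-zero (λ j → unit i (punchIn i j) * y (punchIn i j)) off) ⟩
      1ℚ * y i + 0ℚ                                          ≡⟨ trans (ℚP.+-identityʳ _) (ℚP.*-identityˡ (y i)) ⟩
      y i                                                    ∎
    where
      open ≡-Reasoning
      off : ∀ j → unit i (punchIn i j) * y (punchIn i j) ≡ 0ℚ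
      off j rewrite unit-off i (punchIn i j) (punchInᵢ≢i i j ∘ sym) = ℚP.*-zeroˡ (y (punchIn i j))

  sum-linear : ∀ {n} α β (f g : Fin n → ℚ) → sum (λ l → α * f l - β * g l) ≡ α * sum f - β * sum g
  sum-linear α β f g = begin
      sum (λ l → α * f l - β * g l)              ≡⟨ sum-cong-≗ (λ l → cong (α * f l +_) (ℚP.neg-distribˡ-* β (g l))) ⟩
      sum (λ l → α * f l + (- β) * g l)          ≡⟨ ∑-distrib-+ (λ l → α * f l) (λ l → (- β) * g l) ⟩
      sum (λ l → α * f l) + sum (λ l → (- β) * g l)
        ≡⟨ cong₂ _+_ (sym (*-distribˡ-sum α f)) (sym (*-distribˡ-sum (- β) g)) ⟩
      α * sum f + (- β) * sum g                  ≡⟨ cong (α * sum f +_) (sym (ℚP.neg-distribˡ-* β (sum g))) ⟩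
      α * sum f - β * sum g                      ∎
    where open ≡-Reasoning

  dot-shifted : ∀ {n} α β (y : Fin n → ℚ) l₀ (r : Fin n → ℚ) →
    sum (λ l → (α * y l - β * unit l₀ l) * r l) ≡ α * sum (λ l → y l * r l) - β * r l₀
  dot-shifted α β y l₀ r = begin
      sum (λ l → (α * y l - β * unit l₀ l) * r l)
        ≡⟨ sum-cong-≗ (λ l → expand α (y l) β (unit l₀ l) (r l)) ⟩
      sum (λ l → α * (y l * r l) - β * (unit l₀ l * r l))
        ≡⟨ sum-linear α β (λ l → y l * r l) (λ l → unit l₀ l * r l) ⟩
      α * sum (λ l → y l * r l) - β * sum (λ l → unit l₀ l * r l)
        ≡⟨ cong (λ z → α * sum (λ l → y l * r l) - β * z) (sum-unit l₀ r) ⟩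
      α * sum (λ l → y l * r l) - β * r l₀ ∎
    where
      open ≡-Reasoning
      expand : ∀ α y β e r → (α * y - β * e) * r ≡ α * (y * r) - β * (e * r)
      expand = solve-∀ ℚ-ring

  shifted-off : ∀ {n} α β (y : Fin n → ℚ) {l₀ l} → l₀ ≢ l → α * y l - β * unit l₀ l ≡ α * y l
  shifted-off α β y {l₀} {l} l₀≢l =
    trans (cong (λ e → α * y l - β * e) (unit-off l₀ l l₀≢l)) (drop (α * y l) β)
    where
      drop : ∀ p β → p - β * 0ℚ ≡ p
      drop = solve-∀ ℚ-ring

  dot-combination : ∀ {n} α β (y r s : Fin n → ℚ) →
    sum (λ l → y l * (α * r l - β * s l)) ≡ α * sum (λ l → y l * r l) - β * sum (λ l → y l * s l)
  dot-combination α β y r s =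
    trans (sum-cong-≗ (λ l → distribute α β (y l) (r l) (s l))) (sum-linear α β (λ l → y l * r l) (λ l → y l * s l))
    where
      distribute : ∀ α β y r s → y * (α * r - β * s) ≡ α * (y * r) - β * (y * s)
      distribute = solve-∀ ℚ-ring

  record NontrivialSolution {m n} (a : Fin m → Fin n → ℚ) (Q : Fin m → Bool) (P : Fin n → Bool) : Set where
    field
      x         : Fin n → ℚ
      supported : ∀ l → ¬ T (P l) → x l ≡ 0ℚ
      witness   : Fin n
      nonzero   : x witness ≢ 0ℚ
      solves    : ∀ t → T (Q t) → sum (λ l → x l * a t l) ≡ 0ℚ

  supported-orthogonal : ∀ {n} (P : Fin n → Bool) (x r : Fin n → ℚ) →
    (∀ l → ¬ T (P l) → x l ≡ 0ℚ) → (∀ l → T (P l) → r l ≡ 0ℚ) → sum (λ l → x l * r l) ≡ 0ℚ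
  supported-orthogonal P x r x-supported r-vanishes = sum-zero (λ l → x l * r l) term
    where
      term : ∀ l → x l * r l ≡ 0ℚ
      term l with T? (P l)
      ... | yes Pl  = trans (cong (x l *_) (r-vanishes l Pl)) (ℚP.*-zeroʳ (x l))
      ... | no ¬Pl = trans (cong (_* r l) (x-supported l ¬Pl)) (ℚP.*-zeroˡ (r l))

  basisSolution : ∀ {n} (a : Fin 0 → Fin n → ℚ) Q (P : Fin n → Bool) l → T (P l) → NontrivialSolution a Q P
  basisSolution a Q P l Pl = record
    { x         = unit l
    ; supported = λ l' ¬Pl' → unit-off l l' (λ { refl → ¬Pl' Pl })
    ; witness   = l
    ; nonzero   = λ unit≡0 → 1≢0 (trans (sym (unit-diag l)) unit≡0)
    ; solves    = λ ()
    }
    where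
      1≢0 : 1ℚ ≢ 0ℚ
      1≢0 ()

  findPivot : ∀ {n} (P : Fin n → Bool) (r : Fin n → ℚ) →
    (∃ λ l → T (P l) × r l ≢ 0ℚ) ⊎ (∀ l → T (P l) → r l ≡ 0ℚ)
  findPivot P r with any? (λ l → T? (P l) ×-dec ¬? (r l ≟ 0ℚ))
  ... | yes pivot = inj₁ pivot
  ... | no noPivot = inj₂ λ l Pl → decidable-stable (r l ≟ 0ℚ) (λ rl≢0 → noPivot (l , Pl , rl≢0))

  addTrivialRow : ∀ {m n} (a : Fin (suc m) → Fin n → ℚ) Q P →
    (T (Q zero) → ∀ l → T (P l) → a zero l ≡ 0ℚ) →
    NontrivialSolution (a ∘ suc) (Q ∘ suc) P → NontrivialSolution a Q P
  addTrivialRow a Q P trivial s = record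
    { x = x ; supported = supported ; witness = witness ; nonzero = nonzero ; solves = solves′ }
    where
      open NontrivialSolution s
      solves′ : ∀ t → T (Q t) → sum (λ l → x l * a t l) ≡ 0ℚ
      solves′ zero    Q₀ = supported-orthogonal P x (a zero) supported (trivial Q₀)
      solves′ (suc t) Qt = solves t Qt

  -- Gaussian elimination of the unknown l₀, with pivot row 0:
  -- row t of the reduced system is a_{0,l₀} a_{t+1} − a_{t+1,l₀} a_0.
  eliminate : ∀ {m n} → (Fin (suc m) → Fin n → ℚ) → Fin n → Fin m → Fin n → ℚ
  eliminate a l₀ t l = a zero l₀ * a (suc t) l - a (suc t) l₀ * a zero l

  -- back substitution: from a solution y of the reduced system (unknowns
  -- P ∖ {l₀}) the vector x = a_{0,l₀} y − (y · a₀) e_{l₀} solves the original one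
  backSubstitute : ∀ {m n} (a : Fin (suc m) → Fin n → ℚ) Q P l₀ → T (P l₀) → a zero l₀ ≢ 0ℚ →
    NontrivialSolution (eliminate a l₀) (Q ∘ suc) (remove P l₀) → NontrivialSolution a Q P
  backSubstitute {n = n} a Q P l₀ Pl₀ pivot s = record
    { x = x ; supported = supported ; witness = w ; nonzero = nonzero ; solves = solves }
    where
      open NontrivialSolution s
        renaming (x to y; supported to y-supported; witness to w; nonzero to y-nonzero; solves to y-solves)
      A₀ = a zero l₀
      dot : (Fin n → ℚ) → ℚ
      dot r = sum (λ l → y l * r l)
      S₀ = dot (a zero)

      x : Fin n → ℚ
      x l = A₀ * y l - S₀ * unit l₀ l

      supported : ∀ l → ¬ T (P l) → x l ≡ 0ℚ
      supported l ¬Pl = trans (shifted-off A₀ S₀ y l₀≢l) (trans (cong (A₀ *_) y≡0) (ℚP.*-zeroʳ A₀))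
        where
          y≡0 = y-supported l (λ Rl → ¬Pl (proj₁ (remove-member P l₀ l Rl)))
          l₀≢l : l₀ ≢ l
          l₀≢l refl = ¬Pl Pl₀

      -- the witness of y is not l₀, so x keeps the nonzero entry A₀ y_w there
      nonzero : x w ≢ 0ℚ
      nonzero xw≡0 = *-nonzero A₀ (y w) pivot y-nonzero (trans (sym (shifted-off A₀ S₀ y l₀≢w)) xw≡0)
        where
          Rw = decidable-stable (T? (remove P l₀ w)) (λ ¬Rw → y-nonzero (y-supported w ¬Rw))
          l₀≢w = proj₂ (remove-member P l₀ w Rw)

      solves : ∀ t → T (Q t) → sum (λ l → x l * a t l) ≡ 0ℚ
      solves zero    _  = trans (dot-shifted A₀ S₀ y l₀ (a zero)) (cancel A₀ S₀)
        where
          cancel : ∀ α β → α * β - β * α ≡ 0ℚ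
          cancel = solve-∀ ℚ-ring
      solves (suc t) Qt = begin
          sum (λ l → x l * a (suc t) l)        ≡⟨ dot-shifted A₀ S₀ y l₀ (a (suc t)) ⟩
          A₀ * dot (a (suc t)) - S₀ * aₜ₀      ≡⟨ cong (λ z → A₀ * dot (a (suc t)) - z) (ℚP.*-comm S₀ aₜ₀) ⟩
          A₀ * dot (a (suc t)) - aₜ₀ * S₀      ≡⟨ dot-combination A₀ aₜ₀ y (a (suc t)) (a zero) ⟨
          sum (λ l → y l * eliminate a l₀ t l) ≡⟨ y-solves t Qt ⟩
          0ℚ                                   ∎
        where
          open ≡-Reasoning
          aₜ₀ = a (suc t) l₀

  underdetermined : ∀ {m n} (a : Fin m → Fin n → ℚ) (Q : Fin m → Bool) (P : Fin n → Bool) →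
    count Q ℕ.< count P → NontrivialSolution a Q P
  underdetermined {zero} a Q P Q<P =
    let (l , Pl) = count-witness P Q<P in basisSolution a Q P l Pl
  underdetermined {suc m} a Q P Q<P with T? (Q zero) | findPivot P (a zero)
  ... | yes Q₀ | inj₁ (l₀ , Pl₀ , pivot) =
    backSubstitute a Q P l₀ Pl₀ pivot (underdetermined (eliminate a l₀) (Q ∘ suc) (remove P l₀) fewer)
    where
      fewer : count (Q ∘ suc) ℕ.< count (remove P l₀)
      fewer = ℕ.s<s⁻¹ (subst₂ ℕ._<_ (count-head Q Q₀) (count-remove P l₀ Pl₀) Q<P)
  ... | yes Q₀ | inj₂ rowVanishes = addTrivialRow a Q P (λ _ → rowVanishes) (underdetermined (a ∘ suc) (Q ∘ suc) P fewer)
    where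
      fewer = ℕP.≤-<-trans (count-tail Q) Q<P
  ... | no ¬Q₀ | _ = addTrivialRow a Q P (λ Q₀ → ⊥-elim (¬Q₀ Q₀)) (underdetermined (a ∘ suc) (Q ∘ suc) P fewer)
    where
      fewer = ℕP.≤-<-trans (count-tail Q) Q<P

module Independence where

  open Rationals
  open import Data.Nat using (ℕ; zero; suc)
  open import Data.Rational using (ℚ; 0ℚ; _*_; _+_)
  import Data.Rational.Properties as ℚP
  open import Data.Fin using (Fin; zero; suc)
  open import Data.Product using (_×_; proj₁; proj₂)
  open import Function using (_∘_)
  open import Relation.Binary.PropositionalEquality

  evaluate : ∀ {n} → (Fin n → ℕ × ℕ) → (Fin n → ℚ) → IntPoly → ℚ
  evaluate pt e F = sum (λ i → e i * toℚ (F (proj₁ (pt i)) (proj₂ (pt i))))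

  evaluate-relation : ∀ {m n} (H : Fin m → IntPoly) (d : Fin m → ℚ) (pt : Fin n → ℕ × ℕ) e →
    (∀ i j → Σℚ m (λ l → d l * toℚ (H l i j)) ≡ 0ℚ) →
    sum (λ l → d l * evaluate pt e (H l)) ≡ 0ℚ
  evaluate-relation {m} H d pt e relation = begin
      sum (λ l → d l * sum (λ i → e i * h l i))
        ≡⟨ sum-cong-≗ (λ l → trans (*-distribˡ-sum (d l) (λ i → e i * h l i)) (sum-cong-≗ (λ i → *-swap (d l) (e i) (h l i)))) ⟩
      sum (λ l → sum (λ i → e i * (d l * h l i)))  ≡⟨ ∑-comm (λ l i → e i * (d l * h l i)) ⟩
      sum (λ i → sum (λ l → e i * (d l * h l i)))  ≡⟨ sum-cong-≗ (λ i → sym (*-distribˡ-sum (e i) (λ l → d l * h l i))) ⟩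
      sum (λ i → e i * sum (λ l → d l * h l i))    ≡⟨ sum-zero (λ i → e i * sum (λ l → d l * h l i)) vanishes ⟩
      0ℚ                                           ∎
    where
      open ≡-Reasoning
      h : Fin m → _ → ℚ
      h l i = toℚ (H l (proj₁ (pt i)) (proj₂ (pt i)))
      vanishes : ∀ i → e i * sum (λ l → d l * h l i) ≡ 0ℚ
      vanishes i = begin
          e i * sum (λ l → d l * h l i)  ≡⟨ cong (e i *_) (sym (Σℚ≡sum m _)) ⟩
          e i * Σℚ m (λ l → d l * h l i) ≡⟨ cong (e i *_) (relation _ _) ⟩
          e i * 0ℚ                       ≡⟨ ℚP.*-zeroʳ (e i) ⟩
          0ℚ                             ∎

  extend-independent : ∀ {m n} (H : Fin (suc m) → IntPoly) (pt : Fin n → ℕ × ℕ) e →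
    LinIndep m (H ∘ suc) → (∀ l → evaluate pt e (H (suc l)) ≡ 0ℚ) → evaluate pt e (H zero) ≢ 0ℚ →
    LinIndep (suc m) H
  extend-independent {m} H pt e independent kills keeps d relation = coefficients
    where
      open ≡-Reasoning
      d₀≡0 : d zero ≡ 0ℚ
      d₀≡0 = zero-divisor (evaluate pt e (H zero)) (d zero) (begin
          evaluate pt e (H zero) * d zero ≡⟨ ℚP.*-comm _ (d zero) ⟩
          d zero * evaluate pt e (H zero)
            ≡⟨ sym (ℚP.+-identityʳ _) ⟩
          d zero * evaluate pt e (H zero) + 0ℚ
            ≡⟨ cong (d zero * evaluate pt e (H zero) +_)
                 (sym (sum-zero _ (λ l → trans (cong (d (suc l) *_) (kills l)) (ℚP.*-zeroʳ (d (suc l)))))) ⟩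
          sum (λ l → d l * evaluate pt e (H l)) ≡⟨ evaluate-relation H d pt e relation ⟩
          0ℚ ∎) keeps
      relation-tail : ∀ i j → Σℚ m (λ l → d (suc l) * toℚ (H (suc l) i j)) ≡ 0ℚ
      relation-tail i j = begin
          Σℚ m (λ l → d (suc l) * toℚ (H (suc l) i j))               ≡⟨ sym (ℚP.+-identityˡ _) ⟩
          0ℚ + Σℚ m (λ l → d (suc l) * toℚ (H (suc l) i j))
            ≡⟨ cong (_+ Σℚ m (λ l → d (suc l) * toℚ (H (suc l) i j)))
                 (sym (trans (cong (_* toℚ (H zero i j)) d₀≡0) (ℚP.*-zeroˡ (toℚ (H zero i j))))) ⟩
          Σℚ (suc m) (λ l → d l * toℚ (H l i j))                     ≡⟨ relation i j ⟩
          0ℚ ∎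
      coefficients : ∀ l → d l ≡ 0ℚ
      coefficients zero    = d₀≡0
      coefficients (suc l) = independent (d ∘ suc) relation-tail l

module Derivatives where

  open import Data.Nat as ℕ using (ℕ; zero; suc; _+_; _*_; _!)
  import Data.Nat.Properties as ℕP
  open import Data.Nat.Properties using (_!*_!≢0)
  open import Data.Integer as ℤ using (ℤ; +_)
  import Data.Integer.Properties as ℤP
  open import Data.Integer.Tactic.RingSolver using (solve-∀)
  import Data.Rational as ℚ
  open import Relation.Binary.PropositionalEquality
  open Rationals using (toℚ-*; toℚ-zero)
  import Data.Nat.Tactic.RingSolver as ℕT

  ∂x^-scaled : ∀ u P i j → + (i !) ℤ.* ∂x^ u P i j ≡ + ((i + u) !) ℤ.* P (i + u) j
  ∂x^-scaled zero    P i j = cong (λ n → + (n !) ℤ.* P n j) (sym (ℕP.+-identityʳ i))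
  ∂x^-scaled (suc u) P i j = begin
      + (i !) ℤ.* (+ suc i ℤ.* ∂x^ u P (suc i) j)    ≡⟨ absorb (+ (i !)) (+ suc i) _ ⟩
      (+ suc i ℤ.* + (i !)) ℤ.* ∂x^ u P (suc i) j    ≡⟨ cong (ℤ._* ∂x^ u P (suc i) j) (sym (ℤP.pos-* (suc i) (i !))) ⟩
      + (suc i !) ℤ.* ∂x^ u P (suc i) j              ≡⟨ ∂x^-scaled u P (suc i) j ⟩
      + ((suc i + u) !) ℤ.* P (suc i + u) j          ≡⟨ cong (λ n → + (n !) ℤ.* P n j) (sym (ℕP.+-suc i u)) ⟩
      + ((i + suc u) !) ℤ.* P (i + suc u) j          ∎
    where
      open ≡-Reasoning
      absorb : ∀ a b c → a ℤ.* (b ℤ.* c) ≡ (b ℤ.* a) ℤ.* c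
      absorb = solve-∀

  ∂y^-scaled : ∀ v P i j → + (j !) ℤ.* ∂y^ v P i j ≡ + ((j + v) !) ℤ.* P i (j + v)
  ∂y^-scaled zero    P i j = cong (λ n → + (n !) ℤ.* P i n) (sym (ℕP.+-identityʳ j))
  ∂y^-scaled (suc v) P i j = begin
      + (j !) ℤ.* (+ suc j ℤ.* ∂y^ v P i (suc j))    ≡⟨ absorb (+ (j !)) (+ suc j) _ ⟩
      (+ suc j ℤ.* + (j !)) ℤ.* ∂y^ v P i (suc j)    ≡⟨ cong (ℤ._* ∂y^ v P i (suc j)) (sym (ℤP.pos-* (suc j) (j !))) ⟩
      + (suc j !) ℤ.* ∂y^ v P i (suc j)              ≡⟨ ∂y^-scaled v P i (suc j) ⟩
      + ((suc j + v) !) ℤ.* P i (suc j + v)          ≡⟨ cong (λ n → + (n !) ℤ.* P i n) (sym (ℕP.+-suc j v)) ⟩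
      + ((j + suc v) !) ℤ.* P i (j + suc v)          ∎
    where
      open ≡-Reasoning
      absorb : ∀ a b c → a ℤ.* (b ℤ.* c) ≡ (b ℤ.* a) ℤ.* c
      absorb = solve-∀

  D-scaled : ∀ u v Φ i j → + (i ! * j !) ℤ.* D u v Φ i j ≡ + ((i + u) ! * (j + v) !) ℤ.* Φ (i + u) (j + v)
  D-scaled u v Φ i j = begin
      + (i ! * j !) ℤ.* ∂x^ u Ψ i j                              ≡⟨ cong (ℤ._* ∂x^ u Ψ i j) (ℤP.pos-* (i !) (j !)) ⟩
      (+ (i !) ℤ.* + (j !)) ℤ.* ∂x^ u Ψ i j                      ≡⟨ regroup (+ (i !)) (+ (j !)) _ ⟩
      + (j !) ℤ.* (+ (i !) ℤ.* ∂x^ u Ψ i j)                      ≡⟨ cong (+ (j !) ℤ.*_) (∂x^-scaled u Ψ i j) ⟩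
      + (j !) ℤ.* (+ ((i + u) !) ℤ.* Ψ (i + u) j)                ≡⟨ swap (+ (j !)) (+ ((i + u) !)) _ ⟩
      + ((i + u) !) ℤ.* (+ (j !) ℤ.* Ψ (i + u) j)                ≡⟨ cong (+ ((i + u) !) ℤ.*_) (∂y^-scaled v Φ (i + u) j) ⟩
      + ((i + u) !) ℤ.* (+ ((j + v) !) ℤ.* Φ (i + u) (j + v))    ≡⟨ ℤP.*-assoc (+ ((i + u) !)) (+ ((j + v) !)) _ ⟨
      (+ ((i + u) !) ℤ.* + ((j + v) !)) ℤ.* Φ (i + u) (j + v)    ≡⟨ cong (ℤ._* Φ (i + u) (j + v)) (ℤP.pos-* ((i + u) !) ((j + v) !)) ⟨
      + ((i + u) ! * (j + v) !) ℤ.* Φ (i + u) (j + v)            ∎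
    where
      open ≡-Reasoning
      Ψ = ∂y^ v Φ
      regroup : ∀ a b c → (a ℤ.* b) ℤ.* c ≡ b ℤ.* (a ℤ.* c)
      regroup = solve-∀
      swap : ∀ a b c → a ℤ.* (b ℤ.* c) ≡ b ℤ.* (a ℤ.* c)
      swap = solve-∀

  D-swap : ∀ u v Φ i j → + (i ! * j !) ℤ.* D u v Φ i j ≡ + (u ! * v !) ℤ.* D i j Φ u v
  D-swap u v Φ i j rewrite D-scaled u v Φ i j | D-scaled i j Φ u v | ℕP.+-comm i u | ℕP.+-comm j v = refl

  weight : ℕ → ℕ → ℚ.ℚ
  weight i j = toℚ (+ (i ! * j !))

  weight-nonzero : ∀ i j → weight i j ≢ ℚ.0ℚ
  weight-nonzero i j w≡0 = ℕ.≢-nonZero⁻¹ (i ! * j !) {{i !* j !≢0}} (ℤP.+-injective (toℚ-zero _ w≡0))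

  D-swapℚ : ∀ u v Φ i j → weight i j ℚ.* toℚ (D u v Φ i j) ≡ weight u v ℚ.* toℚ (D i j Φ u v)
  D-swapℚ u v Φ i j = begin
      weight i j ℚ.* toℚ (D u v Φ i j)     ≡⟨ toℚ-* (+ (i ! * j !)) (D u v Φ i j) ⟨
      toℚ (+ (i ! * j !) ℤ.* D u v Φ i j) ≡⟨ cong toℚ (D-swap u v Φ i j) ⟩
      toℚ (+ (u ! * v !) ℤ.* D i j Φ u v) ≡⟨ toℚ-* (+ (u ! * v !)) (D i j Φ u v) ⟩
      weight u v ℚ.* toℚ (D i j Φ u v)     ∎
    where open ≡-Reasoning

  D-vanishes : ∀ k Φ → IsBinaryForm k Φ → ∀ u v i j → (i + j) + (u + v) ≢ k → D u v Φ i j ≡ + 0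
  D-vanishes k Φ form u v i j off = ℤP.*-cancelˡ-≡ (+ (i ! * j !)) _ _ {{i !* j !≢0}} (begin
      + (i ! * j !) ℤ.* D u v Φ i j                          ≡⟨ D-scaled u v Φ i j ⟩
      + ((i + u) ! * (j + v) !) ℤ.* Φ (i + u) (j + v)        ≡⟨ cong (+ ((i + u) ! * (j + v) !) ℤ.*_) (form _ _ off′) ⟩
      + ((i + u) ! * (j + v) !) ℤ.* + 0                      ≡⟨ ℤP.*-zeroʳ (+ ((i + u) ! * (j + v) !)) ⟩
      + 0                                                    ≡⟨ ℤP.*-zeroʳ (+ (i ! * j !)) ⟨
      + (i ! * j !) ℤ.* + 0                                  ∎)
    where
      open ≡-Reasoning
      interchange : ∀ a b c d → (a + c) + (b + d) ≡ (a + b) + (c + d)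
      interchange = ℕT.solve-∀
      off′ : (i + u) + (j + v) ≢ k
      off′ e = off (trans (sym (interchange i j u v)) e)

module MaximalFamily (k : ℕ) (Φ : IntPoly) (form : IsBinaryForm k Φ)
               (N : ℕ) (S : Fin N → ℕ × ℕ) (maximal : IsMaxIndepSubset k Φ N S) where

  open import Data.Nat as ℕ using (ℕ; suc; _+_; _<_; _≤_)
  import Data.Nat.Properties as ℕP
  open import Data.Rational using (ℚ; 0ℚ; _*_; _≟_)
  import Data.Rational.Properties as ℚP
  open import Data.Bool using (T)
  open import Data.Fin using (Fin)
  open import Data.Product using (_×_; _,_; proj₁; proj₂)
  open import Data.Sum using (inj₁; inj₂)
  open import Data.Empty using (⊥)
  open import Relation.Nullary using (yes; no)
  open import Relation.Nullary.Decidable using (T?; decidable-stable)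
  open import Relation.Binary.PropositionalEquality
  open Rationals
  open Counts using (count; level; count-unique)
  open LinearSystems using (NontrivialSolution; underdetermined; supported-orthogonal)
  open Independence using (evaluate; extend-independent)
  open Derivatives using (weight; weight-nonzero; D-swapℚ; D-vanishes)

  u v order : Fin N → ℕ
  u l = proj₁ (S l)
  v l = proj₂ (S l)
  order l = u l + v l

  F : Fin N → IntPoly
  F = derivFamily N S Φ

  independent : LinIndep N F
  independent = proj₁ (proj₂ (proj₂ maximal))

  in-level : ∀ {j} l → T (level order j l) → order l ≡ j
  in-level l = ℕP.≡ᵇ⇒≡ _ _

  -- only Φ^{0,0} = Φ has order 0, and the members are distinct
  order-zero-unique : count (level order 0) ≤ 1
  order-zero-unique = count-unique (level order 0) λ l l′ l₀ l′₀ →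
    proj₁ (proj₂ maximal) l l′ (trans (at-origin l l₀) (sym (at-origin l′ l′₀)))
    where
      at-origin : ∀ l → T (level order 0 l) → S l ≡ (0 , 0)
      at-origin l l₀ = cong₂ _,_ (ℕP.m+n≡0⇒m≡0 (u l) (in-level l l₀)) (ℕP.m+n≡0⇒n≡0 (u l) (in-level l l₀))

  pairing : Fin N → Fin N → ℚ
  pairing t l = weight (u l) (v l) * toℚ (F t (u l) (v l))

  pairing-off : ∀ t l → order l + order t ≢ k → pairing t l ≡ 0ℚ
  pairing-off t l off = begin
      weight (u l) (v l) * toℚ (F t (u l) (v l))
        ≡⟨ cong (λ z → weight (u l) (v l) * toℚ z) (D-vanishes k Φ form (u t) (v t) (u l) (v l) off) ⟩
      weight (u l) (v l) * 0ℚ ≡⟨ ℚP.*-zeroʳ (weight (u l) (v l)) ⟩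
      0ℚ ∎
    where open ≡-Reasoning

  -- If there were fewer members of order j′ = k − j than of order j, a
  -- nonzero combination of members of order j would vanish identically.
  module FewerOfComplementaryOrder (j j′ : ℕ) (complementary : j + j′ ≡ k) (j′<k : j′ < k)
         (fewer : count (level order j′) < count (level order j)) where

    complement : ∀ o → j + o ≡ k → o ≡ j′
    complement o jo≡k = ℕP.+-cancelˡ-≡ j o j′ (trans jo≡k (sym complementary))

    -- x is supported in order j and orthogonal, under the pairing, to every
    -- member of order j′
    open NontrivialSolution (underdetermined pairing (level order j′) (level order j) fewer)

    e : Fin N → ℚ
    e l = x l * weight (u l) (v l)

    φ : IntPoly → ℚ
    φ = evaluate S e

    φ-member : ∀ t → φ (F t) ≡ sum (λ l → x l * pairing t l)
    φ-member t = sum-cong-≗ (λ l → ℚP.*-assoc (x l) _ _)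

    -- φ kills every member of the family: those of order j′ by choice of x,
    -- the others because they pair trivially with members of order j
    φ-kills-family : ∀ t → φ (F t) ≡ 0ℚ
    φ-kills-family t with T? (level order j′ t)
    ... | yes t∈j′ = trans (φ-member t) (solves t t∈j′)
    ... | no t∉j′  = trans (φ-member t) (supported-orthogonal (level order j) x (pairing t) supported off)
      where
        off : ∀ l → T (level order j l) → pairing t l ≡ 0ℚ
        off l l∈j = pairing-off t l λ sum≡k →
          t∉j′ (ℕP.≡⇒≡ᵇ _ _ (complement (order t) (trans (cong (_+ order t) (sym (in-level l l∈j))) sum≡k)))

    -- φ kills every derivative of order j′: otherwise, by the extension
    -- lemma, it could be added to the family, contradicting maximality
    φ-kills-order : ∀ p q → p + q ≡ j′ → φ (D p q Φ) ≡ 0ℚ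
    φ-kills-order p q pq≡j′ with proj₂ (proj₂ (proj₂ maximal)) p q (subst (_< k) (sym pq≡j′) j′<k)
    ... | inj₁ (t , St≡pq) = subst (λ s → φ (D (proj₁ s) (proj₂ s) Φ) ≡ 0ℚ) St≡pq (φ-kills-family t)
    ... | inj₂ dependent   = decidable-stable (φ (D p q Φ) ≟ 0ℚ) λ φ≢0 →
          dependent (extend-independent (derivFamily (suc N) (extend (p , q) S) Φ) S e independent φ-kills-family φ≢0)

    -- by symmetry of the pairing, p! q! times the (p , q) coefficient of
    -- Σₗ xₗ Fₗ is φ(Φ^{p,q})
    coefficient-scaled : ∀ p q → weight p q * sum (λ l → x l * toℚ (F l p q)) ≡ φ (D p q Φ)
    coefficient-scaled p q = trans (*-distribˡ-sum (weight p q) (λ l → x l * toℚ (F l p q))) (sum-cong-≗ λ l → begin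
        weight p q * (x l * toℚ (F l p q))            ≡⟨ *-swap (weight p q) (x l) _ ⟩
        x l * (weight p q * toℚ (F l p q))            ≡⟨ cong (x l *_) (D-swapℚ (u l) (v l) Φ p q) ⟩
        x l * (weight (u l) (v l) * toℚ (D p q Φ (u l) (v l))) ≡⟨ ℚP.*-assoc (x l) _ _ ⟨
        x l * weight (u l) (v l) * toℚ (D p q Φ (u l) (v l))   ∎)
      where
        open ≡-Reasoning

    combination-vanishes : ∀ p q → sum (λ l → x l * toℚ (F l p q)) ≡ 0ℚ
    combination-vanishes p q with p ℕ.+ q ℕ.≟ j′
    ... | yes pq≡j′ = zero-divisor (weight p q) _ (trans (coefficient-scaled p q) (φ-kills-order p q pq≡j′)) (weight-nonzero p q)
    ... | no pq≢j′  = supported-orthogonal (level order j) x (λ l → toℚ (F l p q)) supported off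
      where
        off : ∀ l → T (level order j l) → toℚ (F l p q) ≡ 0ℚ
        off l l∈j = cong toℚ (D-vanishes k Φ form (u l) (v l) p q λ sum≡k →
          pq≢j′ (complement (p + q) (trans (ℕP.+-comm j (p + q)) (trans (cong (p + q +_) (sym (in-level l l∈j))) sum≡k))))

    impossible : ⊥
    impossible = nonzero (independent x (λ p q → trans (Σℚ≡sum N _) (combination-vanishes p q)) witness)

  level-duality : ∀ j j′ → j + j′ ≡ k → j′ < k → count (level order j) ≤ count (level order j′)
  level-duality j j′ complementary j′<k =
    ℕP.≮⇒≥ (FewerOfComplementaryOrder.impossible j j′ complementary j′<k)

module NatSums where

  open import Data.Nat using (ℕ; zero; suc; _+_; _*_; _∸_; _≤_; _<_; _≡ᵇ_; z≤n; s<s)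
  import Data.Nat.Properties as ℕP
  open import Data.Fin using (Fin; zero; suc; toℕ)
  open import Data.Fin.Properties using (opposite-prop; toℕ<n)
  import Data.Fin.Permutation as Permutation
  open import Relation.Binary.PropositionalEquality
  open import Algebra.Properties.Semiring.Sum ℕP.+-*-semiring public
  open Counts using (⟦_⟧)

  Σℕ≡sum : ∀ n (f : Fin n → ℕ) → Σℕ n f ≡ sum f
  Σℕ≡sum zero    f = refl
  Σℕ≡sum (suc n) f = cong (f zero +_) (Σℕ≡sum n (λ l → f (suc l)))

  sum-const : ∀ n c → sum (λ (_ : Fin n) → c) ≡ n * c
  sum-const zero    c = refl
  sum-const (suc n) c = cong (c +_) (sum-const n c)

  sum-mono : ∀ {n} (f g : Fin n → ℕ) → (∀ l → f l ≤ g l) → sum f ≤ sum g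
  sum-mono {zero}  f g f≤g = ℕP.≤-refl
  sum-mono {suc n} f g f≤g = ℕP.+-mono-≤ (f≤g zero) (sum-mono (λ l → f (suc l)) (λ l → g (suc l)) (λ l → f≤g (suc l)))

  sum-indicator : ∀ {k} o → o < k → (g : ℕ → ℕ) → sum (λ (j : Fin k) → ⟦ o ≡ᵇ toℕ j ⟧ * g (toℕ j)) ≡ g o
  sum-indicator {suc k} zero    _         g =
    trans (cong₂ _+_ (ℕP.+-identityʳ (g 0)) (sum-replicate-zero k)) (ℕP.+-identityʳ (g 0))
  sum-indicator {suc k} (suc o) (s<s o<k) g = sum-indicator o o<k (λ n → g (suc n))

  sum-reverse : ∀ {m} (f : ℕ → ℕ) → sum (λ (i : Fin m) → f (toℕ i)) ≡ sum (λ (i : Fin m) → f (m ∸ suc (toℕ i)))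
  sum-reverse {m} f = trans (sum-permute (λ (i : Fin m) → f (toℕ i)) Permutation.reverse) (sum-cong-≗ (λ (i : Fin m) → cong f (opposite-prop i)))

  reflection-inequality : ∀ k (c : ℕ → ℕ) → (∀ j j′ → j + j′ ≡ k → j′ < k → c j ≤ c j′) →
    sum (λ (j : Fin k) → c (toℕ j) * (k ∸ toℕ j)) ≤ c 0 * k + sum (λ (j : Fin k) → c (toℕ j) * toℕ j)
  reflection-inequality zero    c dual = z≤n
  reflection-inequality (suc m) c dual = begin
      c 0 * suc m + sum (λ (i : Fin m) → c (suc (toℕ i)) * (m ∸ toℕ i))
        ≡⟨ cong (c 0 * suc m +_) (sum-reverse {m} (λ t → c (suc t) * (m ∸ t))) ⟩
      c 0 * suc m + sum (λ (i : Fin m) → c (suc (m ∸ suc (toℕ i))) * (m ∸ (m ∸ suc (toℕ i))))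
        ≤⟨ ℕP.+-monoʳ-≤ (c 0 * suc m) (sum-mono _ _ reflected) ⟩
      c 0 * suc m + sum (λ (i : Fin m) → c (suc (toℕ i)) * suc (toℕ i))
        ≡⟨ cong (λ z → c 0 * suc m + (z + sum (λ (i : Fin m) → c (suc (toℕ i)) * suc (toℕ i)))) (ℕP.*-zeroʳ (c 0)) ⟨
      c 0 * suc m + (c 0 * 0 + sum (λ (i : Fin m) → c (suc (toℕ i)) * suc (toℕ i))) ∎
    where
      open ℕP.≤-Reasoning
      reflected : ∀ (i : Fin m) → c (suc (m ∸ suc (toℕ i))) * (m ∸ (m ∸ suc (toℕ i))) ≤ c (suc (toℕ i)) * suc (toℕ i)
      reflected i = begin
          c (suc (m ∸ suc t)) * (m ∸ (m ∸ suc t)) ≡⟨ cong₂ (λ a b → c a * b) (ℕP.+-∸-assoc 1 t<m) (sym (ℕP.m∸[m∸n]≡n t<m)) ⟨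
          c (m ∸ t) * suc t                       ≤⟨ ℕP.*-monoˡ-≤ (suc t) (dual (m ∸ t) (suc t) complementary (s<s t<m)) ⟩
          c (suc t) * suc t                       ∎
        where
          t = toℕ i
          t<m = toℕ<n i
          complementary : (m ∸ t) + suc t ≡ suc m
          complementary = trans (ℕP.+-suc (m ∸ t) t) (cong suc (ℕP.m∸n+n≡m (ℕP.<⇒≤ t<m)))

module GradedCounting (k : ℕ) {N : ℕ} (order : Fin N → ℕ) (bounded : ∀ l → order l ℕ.< k) where

  open import Data.Nat using (_+_; _*_; _∸_; _≤_; _<_)
  import Data.Nat.Properties as ℕP
  open import Data.Fin using (toℕ)
  open import Relation.Binary.PropositionalEquality
  open Counts using (⟦_⟧; count; level)
  open NatSums
  open import Data.Nat.Tactic.RingSolver using (solve-∀)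

  levelCount : ℕ → ℕ
  levelCount j = count (level order j)

  sum-by-level : (g : ℕ → ℕ) → sum (λ l → g (order l)) ≡ sum (λ (j : Fin k) → levelCount (toℕ j) * g (toℕ j))
  sum-by-level g = begin
      sum (λ l → g (order l))
        ≡⟨ sum-cong-≗ (λ l → sym (sum-indicator (order l) (bounded l) g)) ⟩
      sum (λ l → sum (λ (j : Fin k) → ⟦ order l ℕ.≡ᵇ toℕ j ⟧ * g (toℕ j)))
        ≡⟨ ∑-comm (λ l (j : Fin k) → ⟦ order l ℕ.≡ᵇ toℕ j ⟧ * g (toℕ j)) ⟩
      sum (λ (j : Fin k) → sum (λ l → ⟦ order l ℕ.≡ᵇ toℕ j ⟧ * g (toℕ j)))
        ≡⟨ sum-cong-≗ (λ (j : Fin k) → sym (*-distribʳ-sum (g (toℕ j)) (λ l → ⟦ order l ℕ.≡ᵇ toℕ j ⟧))) ⟩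
      sum (λ (j : Fin k) → levelCount (toℕ j) * g (toℕ j)) ∎
    where open ≡-Reasoning

  codegree degree : ℕ
  codegree = sum (λ l → k ∸ order l)
  degree   = sum order

  codegree+degree : codegree + degree ≡ N * k
  codegree+degree = begin
      codegree + degree              ≡⟨ ∑-distrib-+ (λ l → k ∸ order l) order ⟨
      sum (λ l → k ∸ order l + order l) ≡⟨ sum-cong-≗ (λ l → ℕP.m∸n+n≡m (ℕP.<⇒≤ (bounded l))) ⟩
      sum (λ (_ : Fin N) → k)         ≡⟨ sum-const N k ⟩
      N * k                           ∎
    where open ≡-Reasoning

  codegree≤ : (∀ j j′ → j + j′ ≡ k → j′ < k → levelCount j ≤ levelCount j′) →
    codegree ≤ levelCount 0 * k + degree
  codegree≤ duality = begin
      codegree                                                    ≡⟨ sum-by-level (k ∸_) ⟩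
      sum (λ (j : Fin k) → levelCount (toℕ j) * (k ∸ toℕ j))      ≤⟨ reflection-inequality k levelCount duality ⟩
      levelCount 0 * k + sum (λ (j : Fin k) → levelCount (toℕ j) * toℕ j) ≡⟨ cong (levelCount 0 * k +_) (sum-by-level (λ o → o)) ⟨
      levelCount 0 * k + degree                                   ∎
    where open ℕP.≤-Reasoning

  degree-bound : levelCount 0 ≤ 1 → (∀ j j′ → j + j′ ≡ k → j′ < k → levelCount j ≤ levelCount j′) →
    2 * codegree ≤ (1 + N) * k
  degree-bound order-zero duality = begin
      2 * codegree                                   ≡⟨ cong (codegree +_) (ℕP.+-identityʳ codegree) ⟩
      codegree + codegree                            ≤⟨ ℕP.+-monoʳ-≤ codegree (codegree≤ duality) ⟩
      codegree + (levelCount 0 * k + degree)         ≡⟨ regroup codegree (levelCount 0 * k) degree ⟩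
      levelCount 0 * k + (codegree + degree)         ≡⟨ cong (levelCount 0 * k +_) codegree+degree ⟩
      levelCount 0 * k + N * k                       ≤⟨ ℕP.+-monoˡ-≤ (N * k) (ℕP.*-monoˡ-≤ k order-zero) ⟩
      1 * k + N * k                                  ≡⟨ ℕP.*-distribʳ-+ k 1 N ⟨
      (1 + N) * k                                    ∎
    where
      open ℕP.≤-Reasoning
      regroup : ∀ a b c → a + (b + c) ≡ b + (a + c)
      regroup = solve-∀

open import Data.Nat using (_≤_; _*_; _+_; ⌈_/2⌉)
import Data.Nat.Properties as ℕP
open import Data.Product using (proj₁)
open import Relation.Nullary using (¬_)
open import Relation.Binary.PropositionalEquality using (cong)

n≤2⌈n/2⌉ : ∀ n → n ≤ 2 * ⌈ n /2⌉
n≤2⌈n/2⌉ n = begin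
    n                      ≡⟨ ℕP.⌊n/2⌋+⌈n/2⌉≡n n ⟨
    ℕ.⌊ n /2⌋ + ⌈ n /2⌉    ≤⟨ ℕP.+-monoˡ-≤ ⌈ n /2⌉ (ℕP.⌊n/2⌋≤⌈n/2⌉ n) ⟩
    ⌈ n /2⌉ + ⌈ n /2⌉      ≡⟨ cong (⌈ n /2⌉ +_) (ℕP.+-identityʳ ⌈ n /2⌉) ⟨
    2 * ⌈ n /2⌉            ∎
  where open ℕP.≤-Reasoning

-- K = Σₗ (k − oₗ) satisfies 2K ≤ (N + 1) k by the counting argument, and
-- N ≤ 2⌈N/2⌉.
lemma2p11 : (k : ℕ) → 1 ≤ k → (Φ : IntPoly) → IsBinaryForm k Φ → ¬ Degenerate k Φ →
    (N : ℕ) → (S : Fin N → ℕ × ℕ) → IsMaxIndepSubset k Φ N S →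
    2 * diffDegree k N S ≤ (2 * ⌈ N /2⌉ + 1) * k
lemma2p11 k _ Φ form _ N S maximal = begin
    2 * diffDegree k N S     ≡⟨ cong (2 *_) (NatSums.Σℕ≡sum N _) ⟩
    2 * codegree             ≤⟨ degree-bound order-zero-unique level-duality ⟩
    (1 + N) * k              ≤⟨ ℕP.*-monoˡ-≤ k (ℕP.≤-reflexive (ℕP.+-comm 1 N)) ⟩
    (N + 1) * k              ≤⟨ ℕP.*-monoˡ-≤ k (ℕP.+-monoˡ-≤ 1 (n≤2⌈n/2⌉ N)) ⟩
    (2 * ⌈ N /2⌉ + 1) * k    ∎
  where
    open ℕP.≤-Reasoning
    open MaximalFamily k Φ form N S maximal using (order; order-zero-unique; level-duality)
    open GradedCounting k order (proj₁ maximal) using (codegree; degree-bound)
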